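{- Let $p$ be a prime and $A=\{a_1,\ldots,a_d\}\subseteq\mathbf{F}_p^{\ast}$ (with $a_1,\ldots,a_d$ distinct), and let $G=(\mathbf{F}_p,E_A)$ be the Cayley graph with $E_A=\{(x,x+a):x\in\mathbf{F}_p,\ a\in A\}$. Then \[ \beta(G)\le h_p(\langle a_1,\ldots,a_d\rangle)\le\frac{dp}{2}. \]
   Context: $\mathbf{F}_p=\mathbf{Z}/p\mathbf{Z}$, $\mathbf{F}_p^\ast=\mathbf{F}_p\setminus\{0\}$. For $x\in\mathbf{F}_p$, $x\bmod p$ is the least nonnegative integer in the class $x$. For a nonzero $d$-tuple, $\langle a_1,\ldots,a_d\rangle$ denotes its class in projective space $\mathbf{P}^{d-1}(\mathbf{F}_p)$ (tuples identified up to multiplication by elements of $\mathbf{F}_p^\ast$), and its height is $h_p(\langle a_1,\ldots,a_d\rangle)=\min\{\sum_{i=1}^d(ka_i\bmod p):k=1,\ldots,p-1\}$. A directed cycle in a directed graph $(V,E)$ is a sequence of vertices $w_0,\ldots,w_n$, $n\ge1$, with $(w_j,w_{j+1})\in E$ for all $j$ and $w_n=w_0$; a graph is directed acyclic if it has none. $\beta(G)$ is the minimum size of a set $X$ of edges such that $(V,E\setminus X)$ is directed acyclic. -}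

module Defs where

open import Data.Nat using (ℕ; zero; suc; _+_; _*_; _≤_; _<_; _⊓_; NonZero)
open import Data.Nat.DivMod using (_%_; _mod_)
open import Data.Fin using (Fin; toℕ)
open import Data.List using (List; map; length; allFin)
open import Data.Nat.ListAction using (sum)
open import Data.List.Membership.Propositional using (_∈_; _∉_)
open import Data.List.Relation.Unary.All using (All)
open import Data.List.Relation.Unary.Unique.Propositional using (Unique)
open import Data.Product using (Σ; ∃; _×_; _,_)
open import Relation.Binary.PropositionalEquality using (_≡_)
open import Relation.Nullary using (¬_)

-- Elements of F_p are represented by Fin p (the residues 0,…,p-1),
-- so "x mod p" is toℕ x.  Addition in F_p:
_+ₚ_ : {p : ℕ} .{{_ : NonZero p}} → Fin p → Fin p → Fin p
_+ₚ_ {p} x y = (toℕ x + toℕ y) mod p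

CayleyEdge : {p d : ℕ} .{{_ : NonZero p}} → (Fin d → Fin p) → Fin p → Fin p → Set
CayleyEdge {d = d} a x y = Σ (Fin d) λ i → y ≡ x +ₚ a i

HasDirectedCycle : {V : Set} → (V → V → Set) → Set
HasDirectedCycle {V} E =
  Σ ℕ λ n → Σ (ℕ → V) λ w →
    (1 ≤ n) × (∀ j → j < n → E (w j) (w (suc j))) × (w n ≡ w 0)

DirectedAcyclic : {V : Set} → (V → V → Set) → Set
DirectedAcyclic E = ¬ HasDirectedCycle E

RemoveEdges : {V : Set} → (V → V → Set) → List (V × V) → V → V → Set
RemoveEdges E X u v = E u v × ((u , v) ∉ X)

-- "β(G) ≤ b": there is a set X ⊆ E of edges, of size at most b,
-- such that (V, E \ X) is directed acyclic.  (β(G) is the minimum of |X|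
-- over such X; β(G) ≤ b is exactly the existence of such an X with |X| ≤ b.)
BetaAtMost : {V : Set} → (V → V → Set) → ℕ → Set
BetaAtMost {V} E b =
  Σ (List (V × V)) λ X →
    Unique X × All (λ e → E (Data.Product.proj₁ e) (Data.Product.proj₂ e)) X
    × (length X ≤ b) × DirectedAcyclic (RemoveEdges E X)

-- min { f k : k = 1,…,n }  (only used with n ≥ 1; value 0 for n = 0 is a dummy)
minOver : ℕ → (ℕ → ℕ) → ℕ
minOver zero f = 0
minOver (suc zero) f = f 1
minOver (suc (suc n)) f = minOver (suc n) f ⊓ f (suc (suc n))

height : {p d : ℕ} .{{_ : NonZero p}} → (Fin d → Fin p) → ℕ
height {p} {d} a =
  minOver (Data.Nat._∸_ p 1) (λ k → sum (map (λ i → (k * toℕ (a i)) % p) (allFin d)))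

{-# OPTIONS --safe #-}
-- Fix k ∈ 𝔽ₚ* and rank each vertex by r x = k x mod p. Along an edge x → x + aᵢ the rank
-- grows by cᵢ = k aᵢ mod p ≥ 1, except on the cᵢ wrap-around edges, whose sources are the
-- x with r x ∈ [p − cᵢ, p). Deleting these Σᵢ cᵢ edges leaves a graph on which r strictly
-- increases, hence an acyclic one, and choosing k to minimise Σᵢ cᵢ gives β(G) ≤ hₚ.
-- For the second inequality, aᵢ mod p + (p − 1) aᵢ mod p = p whenever aᵢ ≢ 0, so the sums
-- for k = 1 and k = p − 1 add up to d p.
module Submission where

open import Defs
open import Data.Fin using (Fin; toℕ)
open import Data.Fin.Properties using (toℕ<n; toℕ-injective; toℕ-fromℕ<) renaming (_≟_ to _≟ᶠ_)
open import Data.List using (List; []; _∷_; map; length; allFin; applyUpTo; concatMap; deduplicate)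
open import Data.List.Membership.Propositional using (_∈_; lose)
open import Data.List.Membership.Propositional.Properties
  using (∈-allFin; ∈-applyUpTo⁺; ∈-concatMap⁺; ∈-deduplicate⁺; ∈-map⁺)
open import Data.List.Properties
  using (length-++; length-map; length-applyUpTo; length-tabulate; length-deduplicate; map-cong)
open import Data.List.Relation.Unary.All using (All; universal)
open import Data.List.Relation.Unary.All.Properties using (concat⁺; map⁺; deduplicate⁺)
open import Data.List.Relation.Unary.Unique.DecPropositional.Properties using (deduplicate-!)
open import Data.Nat
  using (ℕ; zero; suc; _+_; _*_; _∸_; _≤_; _<_; _<?_; z≤n; s≤s; s≤s⁻¹; NonZero; >-nonZero; nonTrivial⇒n>1)
open import Data.Nat.Coprimality using (Coprime; coprime-Bézout; prime⇒coprime)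
open import Data.Nat.DivMod
open import Data.Nat.Divisibility using (>⇒∤; m%n≡0⇒n∣m)
open import Data.Nat.GCD using (module Bézout)
open import Data.Nat.ListAction using (sum)
open import Data.Nat.Primality using (Prime; prime; euclidsLemma)
open import Data.Nat.Properties
open import Algebra.Properties.CommutativeSemigroup +-commutativeSemigroup using (interchange)
open import Data.Nat.Solver using (module +-*-Solver)
open import Data.Product using (∃; _×_; _,_; proj₁; proj₂)
open import Data.Product.Properties using (≡-dec)
open import Data.Sum using (inj₁; inj₂; [_,_]′)
open import Function using (_∘_)
open import Function.Definitions using (Injective)
open import Relation.Binary.Definitions using (DecidableEquality)
open import Relation.Binary.PropositionalEquality
  using (_≡_; _≢_; refl; sym; trans; cong; cong₂; subst; module ≡-Reasoning)
open import Relation.Nullary using (¬_; yes; no; contradiction)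

acyclic-by-potential : {V : Set} {E : V → V → Set} (φ : V → ℕ) →
  (∀ {u v} → E u v → φ u < φ v) → DirectedAcyclic E
acyclic-by-potential φ increasing (n , w , 1≤n , path , closed) =
  <-irrefl refl (begin-strict
    φ (w 0)     <⟨ m<m+n (φ (w 0)) 1≤n ⟩
    φ (w 0) + n ≤⟨ climbs n ≤-refl ⟩
    φ (w n)     ≡⟨ cong φ closed ⟩
    φ (w 0)     ∎)
  where
  open ≤-Reasoning
  climbs : ∀ j → j ≤ n → φ (w 0) + j ≤ φ (w j)
  climbs zero    _   = ≤-reflexive (+-identityʳ _)
  climbs (suc j) j<n = begin
    φ (w 0) + suc j   ≡⟨ +-suc (φ (w 0)) j ⟩
    suc (φ (w 0) + j) ≤⟨ s≤s (climbs j (<⇒≤ j<n)) ⟩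
    suc (φ (w j))     ≤⟨ increasing (path j j<n) ⟩
    φ (w (suc j))     ∎

acyclic-⊆ : {V : Set} {E E′ : V → V → Set} →
  (∀ {u v} → E′ u v → E u v) → DirectedAcyclic E → DirectedAcyclic E′
acyclic-⊆ E′⊆E acyclic (n , w , 1≤n , path , closed) =
  acyclic (n , w , 1≤n , (λ j j<n → E′⊆E (path j j<n)) , closed)

betaAtMost-deduplicate : {V : Set} {E : V → V → Set} {b : ℕ} → DecidableEquality V →
  (X : List (V × V)) → All (λ e → E (proj₁ e) (proj₂ e)) X → length X ≤ b →
  DirectedAcyclic (RemoveEdges E X) → BetaAtMost E b
betaAtMost-deduplicate {V} {E} _≟_ X X⊆E |X|≤b acyclic =
  X′ , deduplicate-! _≟²_ X , deduplicate⁺ _≟²_ X⊆E , ≤-trans (length-deduplicate _≟²_ X) |X|≤b ,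
  acyclic-⊆ {E = RemoveEdges E X} {RemoveEdges E X′} (λ (e , ∉X′) → e , ∉X′ ∘ ∈-deduplicate⁺ _≟²_) acyclic
  where
  _≟²_ : DecidableEquality (V × V)
  _≟²_ = ≡-dec _≟_ _≟_
  X′ : List (V × V)
  X′ = deduplicate _≟²_ X

minOver-≤ : ∀ n f {k} → 1 ≤ k → k ≤ n → minOver n f ≤ f k
minOver-≤ (suc zero)    f {suc zero}    _   _   = ≤-refl
minOver-≤ (suc zero)    f {suc (suc _)} _   (s≤s ())
minOver-≤ (suc (suc n)) f               1≤k k≤2+n =
  [ (λ k<2+n → ≤-trans (m⊓n≤m _ _) (minOver-≤ (suc n) f 1≤k (s≤s⁻¹ k<2+n)))
  , (λ { refl → m⊓n≤n _ _ })
  ]′ (m≤n⇒m<n∨m≡n k≤2+n)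

minOver-attained : ∀ n f → 1 ≤ n → ∃ λ k → 1 ≤ k × k ≤ n × minOver n f ≡ f k
minOver-attained (suc zero)    f _ = 1 , ≤-refl , ≤-refl , refl
minOver-attained (suc (suc n)) f _
  with minOver-attained (suc n) f (s≤s z≤n) | ⊓-sel (minOver (suc n) f) (f (suc (suc n)))
... | k , 1≤k , k≤n , attained | inj₁ min≡left = k , 1≤k , m≤n⇒m≤1+n k≤n , trans min≡left attained
... | _                        | inj₂ min≡right = suc (suc n) , s≤s z≤n , ≤-refl , min≡right

[m*[n%d]]%d≡[m*n]%d : ∀ m n d .{{_ : NonZero d}} → (m * (n % d)) % d ≡ (m * n) % d
[m*[n%d]]%d≡[m*n]%d m n d = begin
  (m * (n % d)) % d          ≡⟨ %-distribˡ-* m (n % d) d ⟩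
  (m % d * (n % d % d)) % d  ≡⟨ cong (λ r → (m % d * r) % d) (m%n%n≡m%n n d) ⟩
  (m % d * (n % d)) % d      ≡⟨ sym (%-distribˡ-* m n d) ⟩
  (m * n) % d                ∎
  where open ≡-Reasoning

%-inverse : ∀ {m n} .{{_ : NonZero n}} → Coprime n m → ∃ λ x → (x * m) % n ≡ 1 % n
%-inverse {m} {suc q} coprime with coprime-Bézout coprime
... | Bézout.-+ x y 1+xn≡ym = y , (begin
  (y * m) % suc q            ≡⟨ cong (_% suc q) (sym 1+xn≡ym) ⟩
  (1 + x * suc q) % suc q    ≡⟨ [m+kn]%n≡m%n 1 x (suc q) ⟩
  1 % suc q                  ∎)
  where open ≡-Reasoning
-- q ≡ −1 modulo 1 + q, so q * y inverts m when 1 + y * m ≡ 0.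
... | Bézout.+- x y 1+ym≡xn = q * y , (begin
  (q * y * m) % suc q                  ≡⟨ sym ([m+kn]%n≡m%n (q * y * m) 1 (suc q)) ⟩
  (q * y * m + 1 * suc q) % suc q      ≡⟨ cong (_% suc q) rearrange ⟩
  (1 + q * x * suc q) % suc q          ≡⟨ [m+kn]%n≡m%n 1 (q * x) (suc q) ⟩
  1 % suc q                            ∎)
  where
  open ≡-Reasoning
  open +-*-Solver
  rearrange : q * y * m + 1 * suc q ≡ 1 + q * x * suc q
  rearrange = begin
    q * y * m + 1 * suc q  ≡⟨ solve 3 (λ q y m → q :* y :* m :+ con 1 :* (con 1 :+ q)
                                               := con 1 :+ q :* (con 1 :+ y :* m)) refl q y m ⟩
    1 + q * (1 + y * m)    ≡⟨ cong (λ r → 1 + q * r) 1+ym≡xn ⟩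
    1 + q * (x * suc q)    ≡⟨ cong (1 +_) (sym (*-assoc q x (suc q))) ⟩
    1 + q * x * suc q      ∎

[m*n]%p>0 : ∀ {p m n} .{{_ : NonZero p}} → Prime p → 0 < m → m < p → 0 < n → n < p → 0 < (m * n) % p
[m*n]%p>0 {p} {m} {n} p-prime 0<m m<p 0<n n<p = n≢0⇒n>0 λ p∣mn →
  [ >⇒∤ {{>-nonZero 0<m}} m<p , >⇒∤ {{>-nonZero 0<n}} n<p ]′
    (euclidsLemma m n p-prime (m%n≡0⇒n∣m (m * n) p p∣mn))

m%n+[n∸1]*m%n≡n : ∀ {m n} .{{_ : NonZero n}} → 0 < m → m < n → m % n + ((n ∸ 1) * m) % n ≡ n
m%n+[n∸1]*m%n≡n {suc c} {suc q} _ (s≤s c<q) = begin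
  suc c % suc q + (q * suc c) % suc q  ≡⟨ cong₂ _+_ (m<n⇒m%n≡m (s≤s c<q)) negation ⟩
  suc c + (q ∸ c)                      ≡⟨ cong suc (m+[n∸m]≡n (<⇒≤ c<q)) ⟩
  suc q                                ∎
  where
  open ≡-Reasoning
  c+qc≡c[1+q] : c + q * c ≡ c * suc q
  c+qc≡c[1+q] = trans (cong (c +_) (*-comm q c)) (sym (*-suc c q))
  negation : (q * suc c) % suc q ≡ q ∸ c
  negation = begin
    (q * suc c) % suc q            ≡⟨ cong (_% suc q) (*-suc q c) ⟩
    (q + q * c) % suc q            ≡⟨ cong (λ r → (r + q * c) % suc q) (sym (m∸n+n≡m (<⇒≤ c<q))) ⟩
    ((q ∸ c + c) + q * c) % suc q  ≡⟨ cong (_% suc q) (+-assoc (q ∸ c) c (q * c)) ⟩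
    (q ∸ c + (c + q * c)) % suc q  ≡⟨ cong (λ r → (q ∸ c + r) % suc q) c+qc≡c[1+q] ⟩
    (q ∸ c + c * suc q) % suc q    ≡⟨ [m+kn]%n≡m%n (q ∸ c) c (suc q) ⟩
    (q ∸ c) % suc q                ≡⟨ m<n⇒m%n≡m (s≤s (m∸n≤m q c)) ⟩
    q ∸ c                          ∎

length-concatMap : {A B : Set} (f : A → List B) (xs : List A) →
  length (concatMap f xs) ≡ sum (map (length ∘ f) xs)
length-concatMap f []       = refl
length-concatMap f (x ∷ xs) = trans (length-++ (f x)) (cong (length (f x) +_) (length-concatMap f xs))

sum-map+sum-map≡length* : {A : Set} (f g : A → ℕ) {c : ℕ} → (∀ x → f x + g x ≡ c) →
  (xs : List A) → sum (map f xs) + sum (map g xs) ≡ length xs * c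
sum-map+sum-map≡length* f g f+g≡c []       = refl
sum-map+sum-map≡length* f g f+g≡c (x ∷ xs) = trans
  (interchange (f x) (sum (map f xs)) (g x) (sum (map g xs)))
  (cong₂ _+_ (f+g≡c x) (sum-map+sum-map≡length* f g f+g≡c xs))

∈-applyUpTo-offset : {A : Set} (f : ℕ → A) {o s t : ℕ} → o ≤ t → t < o + s →
  f t ∈ applyUpTo (λ j → f (o + j)) s
∈-applyUpTo-offset f {o} {s} {t} o≤t t<o+s =
  subst (λ r → f r ∈ applyUpTo (λ j → f (o + j)) s) o+[t∸o]≡t
    (∈-applyUpTo⁺ (λ j → f (o + j)) (+-cancelˡ-< o _ _ (subst (_< o + s) (sym o+[t∸o]≡t) t<o+s)))
  where
  o+[t∸o]≡t : o + (t ∸ o) ≡ t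
  o+[t∸o]≡t = m+[n∸m]≡n o≤t

heightAt : {p d : ℕ} .{{_ : NonZero p}} → (Fin d → Fin p) → ℕ → ℕ
heightAt {p} {d} a k = sum (map (λ i → (k * toℕ (a i)) % p) (allFin d))

module _ {p d : ℕ} .{{_ : NonZero p}} (p-prime : Prime p)
         (a : Fin d → Fin p) (a≢0 : ∀ i → toℕ (a i) ≢ 0)
         {k : ℕ} (0<k : 0 < k) (k<p : k < p) where

  rank : Fin p → ℕ
  rank x = (k * toℕ x) % p

  rank-+ₚ : ∀ x y → rank (x +ₚ y) ≡ (rank x + rank y) % p
  rank-+ₚ x y = begin
    (k * toℕ ((toℕ x + toℕ y) mod p)) % p  ≡⟨ cong (λ r → (k * r) % p) (toℕ-fromℕ< _) ⟩
    (k * ((toℕ x + toℕ y) % p)) % p        ≡⟨ [m*[n%d]]%d≡[m*n]%d k (toℕ x + toℕ y) p ⟩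
    (k * (toℕ x + toℕ y)) % p              ≡⟨ cong (_% p) (*-distribˡ-+ k (toℕ x) (toℕ y)) ⟩
    (k * toℕ x + k * toℕ y) % p            ≡⟨ %-distribˡ-+ (k * toℕ x) (k * toℕ y) p ⟩
    (rank x + rank y) % p                  ∎
    where open ≡-Reasoning

  0<rank-a : ∀ i → 0 < rank (a i)
  0<rank-a i = [m*n]%p>0 p-prime 0<k k<p (n≢0⇒n>0 (a≢0 i)) (toℕ<n (a i))

  k-inverse : ∃ λ x → (x * k) % p ≡ 1 % p
  k-inverse = %-inverse (prime⇒coprime p-prime {{>-nonZero 0<k}} k<p)

  k⁻¹ : ℕ
  k⁻¹ = proj₁ k-inverse

  unrank : ℕ → Fin p
  unrank r = (k⁻¹ * r) mod p

  unrank-rank : ∀ x → unrank (rank x) ≡ x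
  unrank-rank x = toℕ-injective (begin
    toℕ ((k⁻¹ * rank x) mod p)      ≡⟨ toℕ-fromℕ< _ ⟩
    (k⁻¹ * (k * toℕ x % p)) % p     ≡⟨ [m*[n%d]]%d≡[m*n]%d k⁻¹ (k * toℕ x) p ⟩
    (k⁻¹ * (k * toℕ x)) % p         ≡⟨ cong (_% p) (sym (*-assoc k⁻¹ k (toℕ x))) ⟩
    (k⁻¹ * k * toℕ x) % p           ≡⟨ cong (_% p) (*-comm (k⁻¹ * k) (toℕ x)) ⟩
    (toℕ x * (k⁻¹ * k)) % p         ≡⟨ sym ([m*[n%d]]%d≡[m*n]%d (toℕ x) (k⁻¹ * k) p) ⟩
    (toℕ x * ((k⁻¹ * k) % p)) % p   ≡⟨ cong (λ r → (toℕ x * r) % p) (proj₂ k-inverse) ⟩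
    (toℕ x * (1 % p)) % p           ≡⟨ [m*[n%d]]%d≡[m*n]%d (toℕ x) 1 p ⟩
    (toℕ x * 1) % p                 ≡⟨ cong (_% p) (*-identityʳ (toℕ x)) ⟩
    toℕ x % p                       ≡⟨ m<n⇒m%n≡m (toℕ<n x) ⟩
    toℕ x                           ∎)
    where open ≡-Reasoning

  wrapSources : Fin d → List (Fin p)
  wrapSources i = applyUpTo (λ j → unrank (p ∸ rank (a i) + j)) (rank (a i))

  wrapEdgesAt : Fin d → List (Fin p × Fin p)
  wrapEdgesAt i = map (λ x → x , x +ₚ a i) (wrapSources i)

  wrapEdges : List (Fin p × Fin p)
  wrapEdges = concatMap wrapEdgesAt (allFin d)

  wrapEdges⊆CayleyEdge : All (λ e → CayleyEdge a (proj₁ e) (proj₂ e)) wrapEdges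
  wrapEdges⊆CayleyEdge = concat⁺ (map⁺ {f = wrapEdgesAt} (universal edges (allFin d)))
    where
    edges : ∀ i → All (λ e → CayleyEdge a (proj₁ e) (proj₂ e)) (wrapEdgesAt i)
    edges i = map⁺ (universal (λ _ → i , refl) (wrapSources i))

  length-wrapEdges : length wrapEdges ≡ heightAt a k
  length-wrapEdges = trans (length-concatMap _ (allFin d)) (cong sum (map-cong length-block (allFin d)))
    where
    length-block : ∀ i → length (wrapEdgesAt i) ≡ rank (a i)
    length-block i = trans (length-map _ (wrapSources i)) (length-applyUpTo _ (rank (a i)))

  wrapEdges-complete : ∀ x i → p ≤ rank x + rank (a i) → (x , x +ₚ a i) ∈ wrapEdges
  wrapEdges-complete x i wraps =
    ∈-concatMap⁺ wrapEdgesAt (lose (∈-allFin i) (∈-map⁺ (λ y → y , y +ₚ a i) x∈wrapSources))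
    where
    lower : p ∸ rank (a i) ≤ rank x
    lower = m≤n+o⇒m∸n≤o p (rank (a i)) (subst (p ≤_) (+-comm (rank x) (rank (a i))) wraps)
    upper : rank x < p ∸ rank (a i) + rank (a i)
    upper = subst (rank x <_) (sym (m∸n+n≡m (<⇒≤ (m%n<n _ p)))) (m%n<n _ p)
    x∈wrapSources : x ∈ wrapSources i
    x∈wrapSources = subst (_∈ wrapSources i) (unrank-rank x) (∈-applyUpTo-offset unrank lower upper)

  rank-increasing : ∀ {x y} → RemoveEdges (CayleyEdge a) wrapEdges x y → rank x < rank y
  rank-increasing {x} ((i , refl) , ∉wrapEdges) with rank x + rank (a i) <? p
  ... | no  wraps   = contradiction (wrapEdges-complete x i (≮⇒≥ wraps)) ∉wrapEdges
  ... | yes no-wrap = begin-strict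
    rank x                      <⟨ m<m+n (rank x) (0<rank-a i) ⟩
    rank x + rank (a i)         ≡⟨ sym (m<n⇒m%n≡m no-wrap) ⟩
    (rank x + rank (a i)) % p   ≡⟨ sym (rank-+ₚ x (a i)) ⟩
    rank (x +ₚ a i)             ∎
    where open ≤-Reasoning

  betaAtMost-heightAt : BetaAtMost (CayleyEdge a) (heightAt a k)
  betaAtMost-heightAt = betaAtMost-deduplicate _≟ᶠ_ wrapEdges wrapEdges⊆CayleyEdge
    (≤-reflexive length-wrapEdges) (acyclic-by-potential rank rank-increasing)

heightAt-1+heightAt-[p∸1] : ∀ {p d} .{{_ : NonZero p}} (a : Fin d → Fin p) → (∀ i → toℕ (a i) ≢ 0) →
  heightAt a 1 + heightAt a (p ∸ 1) ≡ d * p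
heightAt-1+heightAt-[p∸1] {p} {d} a a≢0 = begin
  heightAt a 1 + heightAt a (p ∸ 1)  ≡⟨ sum-map+sum-map≡length* _ _ complementary (allFin d) ⟩
  length (allFin d) * p              ≡⟨ cong (_* p) (length-tabulate {n = d} (λ i → i)) ⟩
  d * p                              ∎
  where
  open ≡-Reasoning
  complementary : ∀ i → (1 * toℕ (a i)) % p + ((p ∸ 1) * toℕ (a i)) % p ≡ p
  complementary i = trans (cong (λ r → r % p + ((p ∸ 1) * toℕ (a i)) % p) (*-identityˡ (toℕ (a i))))
    (m%n+[n∸1]*m%n≡n (n≢0⇒n>0 (a≢0 i)) (toℕ<n (a i)))

2*height≤d*p : ∀ {p d} .{{_ : NonZero p}} (a : Fin d → Fin p) → (∀ i → toℕ (a i) ≢ 0) →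
  2 * height a ≤ d * p
2*height≤d*p {suc zero}    a a≢0 = z≤n
2*height≤d*p {suc (suc q)} {d} a a≢0 = begin
  2 * height a                       ≡⟨ cong (height a +_) (+-identityʳ (height a)) ⟩
  height a + height a                ≤⟨ +-mono-≤ (minOver-≤ (suc q) (heightAt a) ≤-refl (s≤s z≤n))
                                                 (minOver-≤ (suc q) (heightAt a) (s≤s z≤n) ≤-refl) ⟩
  heightAt a 1 + heightAt a (suc q)  ≡⟨ heightAt-1+heightAt-[p∸1] a a≢0 ⟩
  d * suc (suc q)                    ∎
  where open ≤-Reasoning

theorem3 : (p d : ℕ) .{{_ : NonZero p}} → Prime p
    → (a : Fin d → Fin p) → Injective _≡_ _≡_ a → (∀ i → ¬ (toℕ (a i) ≡ 0))
    → BetaAtMost (CayleyEdge a) (height a) × (2 * height a ≤ d * p)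
theorem3 zero    d ⦃ () ⦄
theorem3 (suc q) d p-prime@(prime _) a _ a≢0 =
  let k , 0<k , k≤q , height≡heightAt-k = minOver-attained q (heightAt a) 1≤q in
  subst (BetaAtMost (CayleyEdge a)) (sym height≡heightAt-k)
        (betaAtMost-heightAt p-prime a a≢0 0<k (s≤s k≤q)) ,
  2*height≤d*p a a≢0
  where
  1≤q : 1 ≤ q
  1≤q = s≤s⁻¹ (nonTrivial⇒n>1 (suc q))
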